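{- Let $T=(C_1,\dots,C_\ell)$ be a semistandard tableau with entries in $[n]$ and flag of partitions $\lambda^{(1)}\subseteq\cdots\subseteq\lambda^{(n)}$. Then the tableau $\tilde T$ obtained from the jigsaw flag $\tilde\lambda^{(1)}\subseteq\cdots\subseteq\tilde\lambda^{(n)}$ equals the complement tableau $\bar T=([n]\setminus C_\ell,[n]\setminus C_{\ell-1},\dots,[n]\setminus C_1)$, where empty columns (arising from $C_j=[n]$) are deleted.
   Context: A semistandard tableau with entries in $[n]=\{1,\dots,n\}$ is a left-justified Young diagram filled with elements of $[n]$, weakly increasing along rows and strictly increasing down columns; $C_j$ is the entry set of column $j$. For $k\in[n]$, $\lambda^{(k)}=(\lambda^{(k)}_1,\dots,\lambda^{(k)}_k)$ is the shape of the subtableau of cells with entries $\le k$. Tableaux correspond bijectively to flags $()=\lambda^{(0)}\subseteq\lambda^{(1)}\subseteq\cdots\subseteq\lambda^{(n)}$ with $\lambda^{(k)}$ having at most $k$ parts and each $\lambda^{(k)}-\lambda^{(k-1)}$ a horizontal strip (at most one cell per column): the cells of $\lambda^{(k)}-\lambda^{(k-1)}$ are labelled $k$. Jigsaw flag: $\tilde\lambda^{(i)}=(\lambda^{(n)}_1-\lambda^{(i)}_i,\ \lambda^{(n)}_1-\lambda^{(i)}_{i-1},\dots,\lambda^{(n)}_1-\lambda^{(i)}_1)$ for $i\in[n]$; its consecutive differences are horizontal strips, so it defines a tableau $\tilde T$. -}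

module Defs where

open import Data.Nat using (ℕ; zero; suc; _+_; _∸_; _≤_; _<_; _≡ᵇ_; _<ᵇ_; _≤ᵇ_)
open import Data.Bool using (Bool; true; false; not; _∧_)
open import Data.List using (List; []; _∷_; length; map; filterᵇ; mapMaybe; reverse; upTo; head; drop)
open import Data.Bool.ListAction using (any)
open import Data.List.Relation.Unary.All using (All)
open import Data.List.Relation.Unary.Linked using (Linked)
open import Data.Maybe using (Maybe; just; nothing)
open import Data.Product using (_×_)
open import Relation.Binary.PropositionalEquality using (_≡_; _≢_)

-- A tableau is its list of columns C₁ … C_ℓ (left to right); each column is
-- the list of its entries read top to bottom.  Entries are natural numbers.
Column : Set
Column = List ℕ

Tableau : Set
Tableau = List Column

range : ℕ → List ℕ
range n = map suc (upTo n)

entryAt : Column → ℕ → Maybe ℕ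
entryAt C i = head (drop i C)

-- Rows are weakly increasing between adjacent columns C (left), D (right):
-- D is not longer than C (left-justified diagram) and C[i] ≤ D[i].
RowCompatible : Column → Column → Set
RowCompatible C D =
  (length D ≤ length C) ×
  (∀ i x y → entryAt C i ≡ just x → entryAt D i ≡ just y → x ≤ y)

SSYT : ℕ → Tableau → Set
SSYT n T =
  All (λ C → C ≢ []) T ×
  All (All (λ x → (1 ≤ x) × (x ≤ n))) T ×
  All (Linked _<_) T ×
  Linked RowCompatible T

-- Row r (1-based) of T, left to right.
row : Tableau → ℕ → List ℕ
row T r = mapMaybe (λ C → entryAt C (r ∸ 1)) T

count : (ℕ → Bool) → List ℕ → ℕ
count p xs = length (filterᵇ p xs)

-- A flag is encoded as μ k r = μ^{(k)}_r  (k = 0 … n, rows r = 1, 2, …).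
Flag : Set
Flag = ℕ → ℕ → ℕ

flagOf : Tableau → Flag
flagOf T k r = count (λ x → x ≤ᵇ k) (row T r)

-- Jigsaw flag:  λ̃^{(i)} = (λ^{(n)}_1 − λ^{(i)}_i, …, λ^{(n)}_1 − λ^{(i)}_1),
-- i.e. λ̃^{(i)}_j = λ^{(n)}_1 − λ^{(i)}_{i+1−j} for 1 ≤ j ≤ i, and 0 for
-- j > i (and λ̃^{(0)} = ()).
jigsaw : ℕ → Flag → Flag
jigsaw n lam i j with (1 ≤ᵇ j) ∧ (j ≤ᵇ i)
... | true  = lam n 1 ∸ lam i (suc i ∸ j)
... | false = 0

-- Number of cells in column c (1-based) of the partition μ^{(k)}
-- (rows 1 … n suffice since all parts beyond n are zero).
colLen : ℕ → Flag → ℕ → ℕ → ℕ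
colLen n μ k c = count (λ r → c ≤ᵇ μ k r) (range n)

-- The tableau defined by a flag μ^{(0)} ⊆ … ⊆ μ^{(n)}: the cells of
-- μ^{(k)} − μ^{(k−1)} are labelled k.  Column c (c = 1 … μ^{(n)}_1) has as
-- entries exactly those k ∈ [n] for which the strip μ^{(k)} − μ^{(k−1)}
-- has a cell in column c, listed increasingly (top to bottom).
tableauOfFlag : ℕ → Flag → Tableau
tableauOfFlag n μ =
  map (λ c → filterᵇ (λ k → colLen n μ (k ∸ 1) c <ᵇ colLen n μ k c) (range n))
      (range (μ n 1))

complementCol : ℕ → Column → Column
complementCol n C = filterᵇ (λ x → not (any (λ y → x ≡ᵇ y) C)) (range n)

nonEmpty : Column → Bool
nonEmpty [] = false
nonEmpty (_ ∷ _) = true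

complementTableau : ℕ → Tableau → Tableau
complementTableau n T = filterᵇ nonEmpty (map (complementCol n) (reverse T))

-- Since rows and columns increase, the cell
-- in row s and column j lies in λ^{(k)} iff C_j has at least s entries ≤ k.
-- Unfolding the jigsaw flag, row r of λ̃^{(k)} therefore reaches column ℓ + 1 − j
-- iff r ≤ k − #{x ∈ C_j ∣ x ≤ k} = |[k] ∖ C_j|, so that column of λ̃^{(k)} has
-- |[k] ∖ C_j| cells.  Its length grows from step k − 1 to step k exactly when
-- k ∉ C_j, hence column ℓ + 1 − j of T̃ is [n] ∖ C_j.  Finally T̃ has
-- λ̃^{(n)}_1 = ℓ − λ^{(n)}_n columns, and the columns it omits are the complements
-- of the λ^{(n)}_n full columns C_j = [n], which are exactly the empty ones.

module Submission where

open import Defs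
open import Data.Bool using (Bool; true; false; not; T)
open import Data.Bool.ListAction using (any)
open import Data.Bool.Properties using (T-≡)
open import Data.List using (List; []; _∷_; _++_; _∷ʳ_; length; map; filterᵇ; mapMaybe; reverse; upTo; head; drop)
open import Data.List.Properties
  using (filter-accept; filter-reject; filter-all; filter-none; filter-++; length-filter; length-++;
         map-++; map-upTo; upTo-∷ʳ; unfold-reverse; ++-identityʳ)
open import Data.List.Relation.Unary.All as All using (All; []; _∷_)
open import Data.List.Relation.Unary.All.Properties using (applyUpTo⁺₁)
open import Data.List.Relation.Unary.AllPairs using (_∷_)
open import Data.List.Relation.Unary.Linked as Linked using (Linked)
open import Data.List.Relation.Unary.Linked.Properties using (Linked⇒AllPairs)
open import Data.Maybe using (Maybe; just; nothing; maybe′)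
open import Data.Maybe.Properties using (just-injective)
open import Data.Nat using (ℕ; zero; suc; _+_; _∸_; _⊓_; _≤_; _<_; _≤ᵇ_; _<ᵇ_; _≡ᵇ_; z≤n; s≤s; z<s; s<s; s≤s⁻¹)
open import Data.Nat.Properties
open import Algebra.Properties.CommutativeSemigroup +-commutativeSemigroup using (interchange)
open import Data.Product using (_×_; _,_; proj₁; proj₂; ∃-syntax)
open import Function using (_∘_; _⇔_; mk⇔; Equivalence)
open import Function.Construct.Symmetry using (⇔-sym)
open import Function.Related.Propositional using (module EquationalReasoning)
open import Relation.Binary.PropositionalEquality
  using (_≡_; _≢_; refl; sym; trans; cong; cong₂; subst; module ≡-Reasoning)
open import Relation.Nullary using (Dec; yes; no; ¬_; contradiction; T?)
open import Relation.Nullary.Decidable using (dec-true; dec-false; does-⇔)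

open Equivalence using (to; from)

indicator : Bool → ℕ
indicator true  = 1
indicator false = 0

≤ᵇ-true : ∀ {m n} → m ≤ n → (m ≤ᵇ n) ≡ true
≤ᵇ-true {m} {n} = dec-true (m ≤? n)

≤ᵇ-false : ∀ {m n} → ¬ m ≤ n → (m ≤ᵇ n) ≡ false
≤ᵇ-false {m} {n} = dec-false (m ≤? n)

≡ᵇ-refl : ∀ x → (x ≡ᵇ x) ≡ true
≡ᵇ-refl x = dec-true (x ≟ x) refl

≡ᵇ-false : ∀ {x y} → x ≢ y → (x ≡ᵇ y) ≡ false
≡ᵇ-false {x} {y} = dec-false (x ≟ y)

indicator-<ᵇ-suc : ∀ x k → indicator (x <ᵇ suc k) ≡ indicator (x <ᵇ k) + indicator (x ≡ᵇ k)
indicator-<ᵇ-suc zero    zero    = refl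
indicator-<ᵇ-suc zero    (suc k) = refl
indicator-<ᵇ-suc (suc x) zero    = refl
indicator-<ᵇ-suc (suc x) (suc k) = indicator-<ᵇ-suc x k

indicator-≤ᵇ-suc : ∀ x k → indicator (x ≤ᵇ suc k) ≡ indicator (x ≤ᵇ k) + indicator (x ≡ᵇ suc k)
indicator-≤ᵇ-suc zero    k = refl
indicator-≤ᵇ-suc (suc x) k = indicator-<ᵇ-suc x k

indicator-+-not : ∀ b → indicator b + indicator (not b) ≡ 1
indicator-+-not true  = refl
indicator-+-not false = refl

<ᵇ-+-indicator : ∀ m b → (m <ᵇ m + indicator b) ≡ b
<ᵇ-+-indicator zero    true  = refl
<ᵇ-+-indicator zero    false = refl
<ᵇ-+-indicator (suc m) b     = <ᵇ-+-indicator m b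

∸-cancelʳ-≤′ : ∀ {ℓ j x} → j < ℓ → ℓ ∸ j ≤ ℓ ∸ x → x ≤ j
∸-cancelʳ-≤′ {ℓ} {j} {x} j<ℓ ℓ∸j≤ℓ∸x = ∸-cancelʳ-≤ (<⇒≤ x<ℓ) ℓ∸j≤ℓ∸x
  where
    x<ℓ : x < ℓ
    x<ℓ = m∸n≢0⇒n<m (λ ℓ∸x≡0 → <⇒≱ (m<n⇒0<n∸m j<ℓ) (subst (ℓ ∸ j ≤_) ℓ∸x≡0 ℓ∸j≤ℓ∸x))

≤∸⇒≤∸ : ∀ {m n o} → n ≤ o → m ≤ o ∸ n → n ≤ o ∸ m
≤∸⇒≤∸ {m} {n} {o} n≤o m≤o∸n = m+n≤o⇒m≤o∸n n (subst (_≤ o) (+-comm m n) (m≤o∸n⇒m+n≤o m n≤o m≤o∸n))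

module _ {A : Set} where

  at : List A → ℕ → Maybe A
  at xs i = head (drop i xs)

  at-length : ∀ xs i {x} → at xs i ≡ just x → i < length xs
  at-length (y ∷ xs) zero    _ = z<s
  at-length (y ∷ xs) (suc i) e = s<s (at-length xs i e)

  length⇒at : ∀ xs i → i < length xs → ∃[ x ] at xs i ≡ just x
  length⇒at (y ∷ xs) zero    _         = y , refl
  length⇒at (y ∷ xs) (suc i) (s<s i<n) = length⇒at xs i i<n

  All-at : ∀ {P : A → Set} {xs} → All P xs → ∀ i {x} → at xs i ≡ just x → P x
  All-at (px ∷ _)   zero    refl = px
  All-at (_  ∷ pxs) (suc i) e    = All-at pxs i e

count′ : {A : Set} → (A → Bool) → List A → ℕ
count′ p xs = length (filterᵇ p xs)

module _ {A : Set} (p : A → Bool) where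

  count′-∷ : ∀ x xs → count′ p (x ∷ xs) ≡ indicator (p x) + count′ p xs
  count′-∷ x xs with p x
  ... | true  = refl
  ... | false = refl

  count′-∷ʳ : ∀ xs x → count′ p (xs ∷ʳ x) ≡ count′ p xs + indicator (p x)
  count′-∷ʳ xs x = begin
    length (filterᵇ p (xs ++ x ∷ []))            ≡⟨ cong length (filter-++ (T? ∘ p) xs (x ∷ [])) ⟩
    length (filterᵇ p xs ++ filterᵇ p (x ∷ []))   ≡⟨ length-++ (filterᵇ p xs) ⟩
    count′ p xs + count′ p (x ∷ [])               ≡⟨ cong (count′ p xs +_) (trans (count′-∷ x []) (+-identityʳ _)) ⟩
    count′ p xs + indicator (p x)                 ∎
    where open ≡-Reasoning

-- the elements satisfying p form an initial segment of the list
Downward : {A : Set} → (A → Bool) → List A → Set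
Downward p = Linked (λ x y → T (p y) → T (p x))

module _ {A : Set} {p : A → Bool} where

  Downward-rejectsTail : ∀ {y ys} → Downward p (y ∷ ys) → ¬ T (p y) → All (λ z → ¬ T (p z)) ys
  Downward-rejectsTail d ¬py with Linked⇒AllPairs (λ f g → f ∘ g) d
  ... | descends ∷ _ = All.map (λ py→pz pz → ¬py (py→pz pz)) descends

  count′-Downward : ∀ {xs} → Downward p xs → ∀ i →
                    i < count′ p xs ⇔ (∃[ x ] at xs i ≡ just x × T (p x))
  count′-Downward {[]}     _ zero    = mk⇔ (λ ()) (λ ())
  count′-Downward {[]}     _ (suc i) = mk⇔ (λ ()) (λ ())
  count′-Downward {y ∷ ys} d i with p y in py
  count′-Downward {y ∷ ys} d zero    | true = mk⇔ (λ _ → y , refl , subst T (sym py) _) (λ _ → z<s)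
  count′-Downward {y ∷ ys} d (suc i) | true =
    mk⇔ (to ih ∘ s≤s⁻¹) (s<s ∘ from ih)
    where ih = count′-Downward (Linked.tail d) i
  ... | false = mk⇔ (λ i<c → contradiction (subst (i <_) ys-count i<c) (λ ())) rejected
    where
      ¬py : ¬ T (p y)
      ¬py t = subst T py t
      ys-count : count′ p ys ≡ 0
      ys-count = cong length (filter-none (T? ∘ p) (Downward-rejectsTail d ¬py))
      rejected : ∀ {i} → ∃[ x ] at (y ∷ ys) i ≡ just x × T (p x) → i < count′ p ys
      rejected {zero}  (x , refl , px) = contradiction px ¬py
      rejected {suc i} (x , e , px)    = contradiction px (All-at (Downward-rejectsTail d ¬py) i e)

count′-mapMaybe : ∀ {A B : Set} (p : B → Bool) (f : A → Maybe B) xs →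
                  count′ p (mapMaybe f xs) ≡ count′ (maybe′ p false ∘ f) xs
count′-mapMaybe p f []       = refl
count′-mapMaybe p f (x ∷ xs) with f x
... | nothing = count′-mapMaybe p f xs
... | just y with p y
...   | true  = cong suc (count′-mapMaybe p f xs)
...   | false = count′-mapMaybe p f xs

T-maybe′ : ∀ {A : Set} (p : A → Bool) m → T (maybe′ p false m) ⇔ (∃[ x ] m ≡ just x × T (p x))
T-maybe′ p (just x) = mk⇔ (λ px → x , refl , px) (λ { (_ , refl , px) → px })
T-maybe′ p nothing  = mk⇔ (λ ()) (λ { (_ , () , _) })

range-suc : ∀ k → range (suc k) ≡ range k ∷ʳ suc k
range-suc k = trans (cong (map suc) (sym (upTo-∷ʳ k))) (map-++ suc (upTo k) (k ∷ []))

All-range : ∀ n → All (λ r → 1 ≤ r × r ≤ n) (range n)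
All-range n = subst (All _) (sym (map-upTo suc n)) (applyUpTo⁺₁ suc n (λ i<n → s≤s z≤n , i<n))

filterᵇ-cong-local : ∀ {A : Set} {p q : A → Bool} {xs} →
                     All (λ x → p x ≡ q x) xs → filterᵇ p xs ≡ filterᵇ q xs
filterᵇ-cong-local []                          = refl
filterᵇ-cong-local {p = p} {q} {x ∷ _} (px≡qx ∷ eqs) with p x | q x | px≡qx
... | true  | .true  | refl = cong (x ∷_) (filterᵇ-cong-local eqs)
... | false | .false | refl = filterᵇ-cong-local eqs

filterᵇ-cong-range : ∀ n {p q : ℕ → Bool} → (∀ r → 1 ≤ r → r ≤ n → p r ≡ q r) →
                     filterᵇ p (range n) ≡ filterᵇ q (range n)
filterᵇ-cong-range n eq = filterᵇ-cong-local (All.map (λ (1≤r , r≤n) → eq _ 1≤r r≤n) (All-range n))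

count-≤ᵇ-range : ∀ m n → count (_≤ᵇ m) (range n) ≡ n ⊓ m
count-≤ᵇ-range m zero    = refl
count-≤ᵇ-range m (suc n) = begin
  count (_≤ᵇ m) (range (suc n))             ≡⟨ cong (count (_≤ᵇ m)) (range-suc n) ⟩
  count (_≤ᵇ m) (range n ∷ʳ suc n)          ≡⟨ count′-∷ʳ (_≤ᵇ m) (range n) (suc n) ⟩
  count (_≤ᵇ m) (range n) + indicator (suc n ≤ᵇ m)
                                            ≡⟨ cong (_+ indicator (suc n ≤ᵇ m)) (count-≤ᵇ-range m n) ⟩
  n ⊓ m + indicator (suc n ≤ᵇ m)            ≡⟨ lastStep (suc n ≤? m) ⟩
  suc n ⊓ m                                 ∎
  where
    open ≡-Reasoning
    lastStep : Dec (suc n ≤ m) → n ⊓ m + indicator (suc n ≤ᵇ m) ≡ suc n ⊓ m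
    lastStep (yes n<m)
      rewrite ≤ᵇ-true n<m | m≤n⇒m⊓n≡m (<⇒≤ n<m) | m≤n⇒m⊓n≡m n<m = +-comm n 1
    lastStep (no n≮m)
      rewrite ≤ᵇ-false n≮m | m≥n⇒m⊓n≡n (≮⇒≥ n≮m) | m≥n⇒m⊓n≡n (≤-trans (≮⇒≥ n≮m) (n≤1+n n)) = +-identityʳ m

map-range-reverse : ∀ {A B : Set} (g : ℕ → B) (h : A → B) xs →
                    (∀ j {x} → at xs j ≡ just x → g (length xs ∸ j) ≡ h x) →
                    map g (range (length xs)) ≡ map h (reverse xs)
map-range-reverse g h []       _   = refl
map-range-reverse g h (x ∷ xs) hyp = begin
  map g (range (suc (length xs)))                     ≡⟨ cong (map g) (range-suc (length xs)) ⟩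
  map g (range (length xs) ∷ʳ suc (length xs))        ≡⟨ map-++ g (range (length xs)) _ ⟩
  map g (range (length xs)) ∷ʳ g (suc (length xs))
    ≡⟨ cong₂ _∷ʳ_ (map-range-reverse g h xs (λ j → hyp (suc j))) (hyp 0 refl) ⟩
  map h (reverse xs) ∷ʳ h x                           ≡⟨ map-++ h (reverse xs) (x ∷ []) ⟨
  map h (reverse xs ∷ʳ x)                             ≡⟨ cong (map h) (unfold-reverse x xs) ⟨
  map h (reverse (x ∷ xs))                            ∎
  where open ≡-Reasoning

filterᵇ-map-range-suc : ∀ {A : Set} (p : A → Bool) (f : ℕ → A) m →
  filterᵇ p (map f (range (suc m))) ≡ filterᵇ p (map f (range m)) ++ filterᵇ p (f (suc m) ∷ [])
filterᵇ-map-range-suc p f m =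
  trans (cong (filterᵇ p) (trans (cong (map f) (range-suc m)) (map-++ f (range m) _)))
        (filter-++ (T? ∘ p) (map f (range m)) _)

filterᵇ-map-range-prefix : ∀ {A : Set} (p : A → Bool) (f : ℕ → A) {M} m → M ≤ m →
  (∀ c → 1 ≤ c → c ≤ m → p (f c) ≡ (c ≤ᵇ M)) → filterᵇ p (map f (range m)) ≡ map f (range M)
filterᵇ-map-range-prefix p f zero    z≤n _ = refl
filterᵇ-map-range-prefix p f {M} (suc m) M≤1+m hyp
  rewrite filterᵇ-map-range-suc p f m with M ≟ suc m
... | yes refl = begin
  filterᵇ p (map f (range m)) ++ filterᵇ p (f (suc m) ∷ [])
    ≡⟨ cong₂ _++_ (filterᵇ-map-range-prefix p f m ≤-refl allBefore)
                  (filter-accept (T? ∘ p) (from T-≡ (trans lastTest (≤ᵇ-true (≤-refl {suc m}))))) ⟩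
  map f (range m) ∷ʳ f (suc m)
    ≡⟨ trans (cong (map f) (range-suc m)) (map-++ f (range m) _) ⟨
  map f (range (suc m)) ∎
  where
    open ≡-Reasoning
    lastTest = hyp (suc m) (s≤s z≤n) ≤-refl
    allBefore : ∀ c → 1 ≤ c → c ≤ m → p (f c) ≡ (c ≤ᵇ m)
    allBefore c 1≤c c≤m =
      trans (hyp c 1≤c (m≤n⇒m≤1+n c≤m)) (trans (≤ᵇ-true (m≤n⇒m≤1+n c≤m)) (sym (≤ᵇ-true c≤m)))
... | no M≢1+m = begin
  filterᵇ p (map f (range m)) ++ filterᵇ p (f (suc m) ∷ [])
    ≡⟨ cong₂ _++_ (filterᵇ-map-range-prefix p f m M≤m (λ c 1≤c c≤m → hyp c 1≤c (m≤n⇒m≤1+n c≤m)))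
                  (filter-reject (T? ∘ p) (subst T (trans lastTest (≤ᵇ-false (<⇒≱ (s≤s M≤m)))))) ⟩
  map f (range M) ++ []
    ≡⟨ ++-identityʳ _ ⟩
  map f (range M) ∎
  where
    open ≡-Reasoning
    lastTest = hyp (suc m) (s≤s z≤n) ≤-refl
    M≤m : M ≤ m
    M≤m = s≤s⁻¹ (≤∧≢⇒< M≤1+m M≢1+m)

sorted⇒Downward : ∀ {k xs} → Linked _≤_ xs → Downward (_≤ᵇ k) xs
sorted⇒Downward {k} = Linked.map (λ {x} {y} x≤y y≤k → ≤⇒≤ᵇ (≤-trans x≤y (≤ᵇ⇒≤ y k y≤k)))

count-≤ᵇ-suc : ∀ k xs → count (_≤ᵇ suc k) xs ≡ count (_≤ᵇ k) xs + count (_≡ᵇ suc k) xs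
count-≤ᵇ-suc k []       = refl
count-≤ᵇ-suc k (x ∷ xs) = begin
  count (_≤ᵇ suc k) (x ∷ xs)
    ≡⟨ count′-∷ (_≤ᵇ suc k) x xs ⟩
  indicator (x ≤ᵇ suc k) + count (_≤ᵇ suc k) xs
    ≡⟨ cong₂ _+_ (indicator-≤ᵇ-suc x k) (count-≤ᵇ-suc k xs) ⟩
  (indicator (x ≤ᵇ k) + indicator (x ≡ᵇ suc k)) + (count (_≤ᵇ k) xs + count (_≡ᵇ suc k) xs)
    ≡⟨ interchange (indicator (x ≤ᵇ k)) _ _ _ ⟩
  (indicator (x ≤ᵇ k) + count (_≤ᵇ k) xs) + (indicator (x ≡ᵇ suc k) + count (_≡ᵇ suc k) xs)
    ≡⟨ sym (cong₂ _+_ (count′-∷ (_≤ᵇ k) x xs) (count′-∷ (_≡ᵇ suc k) x xs)) ⟩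
  count (_≤ᵇ k) (x ∷ xs) + count (_≡ᵇ suc k) (x ∷ xs) ∎
  where open ≡-Reasoning

count-≡ᵇ-strict : ∀ y {xs} → Linked _<_ xs → count (_≡ᵇ y) xs ≡ indicator (any (y ≡ᵇ_) xs)
count-≡ᵇ-strict y {[]}     _      = refl
count-≡ᵇ-strict y {x ∷ xs} strict with x ≟ y
... | yes refl rewrite ≡ᵇ-refl x = cong suc noLaterCopy
  where
    noLaterCopy : count (_≡ᵇ x) xs ≡ 0
    noLaterCopy with Linked⇒AllPairs <-trans strict
    ... | x<xs ∷ _ = cong length (filter-none (T? ∘ (_≡ᵇ x))
                       (All.map (λ x<z z≡x → <-irrefl (sym (≡ᵇ⇒≡ _ _ z≡x)) x<z) x<xs))
... | no x≢y rewrite ≡ᵇ-false x≢y | ≡ᵇ-false (x≢y ∘ sym) = count-≡ᵇ-strict y (Linked.tail strict)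

count-≤ᵇ-suc-strict : ∀ k {C} → Linked _<_ C →
                      count (_≤ᵇ suc k) C ≡ count (_≤ᵇ k) C + indicator (any (suc k ≡ᵇ_) C)
count-≤ᵇ-suc-strict k {C} strict =
  trans (count-≤ᵇ-suc k C) (cong (count (_≤ᵇ k) C +_) (count-≡ᵇ-strict (suc k) strict))

length-complementCol-suc : ∀ k C →
  length (complementCol (suc k) C) ≡ length (complementCol k C) + indicator (not (any (suc k ≡ᵇ_) C))
length-complementCol-suc k C =
  trans (cong (count′ notInC) (range-suc k)) (count′-∷ʳ notInC (range k) (suc k))
  where notInC = λ x → not (any (x ≡ᵇ_) C)

count+length-complementCol : ∀ k {C} → Linked _<_ C → All (1 ≤_) C →
                             count (_≤ᵇ k) C + length (complementCol k C) ≡ k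
count+length-complementCol zero    _      positive =
  trans (+-identityʳ _)
        (cong length (filter-none (T? ∘ (_≤ᵇ 0)) (All.map (λ 1≤x x≤0 → <⇒≱ 1≤x (≤ᵇ⇒≤ _ 0 x≤0)) positive)))
count+length-complementCol (suc k) {C} strict positive = begin
  count (_≤ᵇ suc k) C + length (complementCol (suc k) C)
    ≡⟨ cong₂ _+_ (count-≤ᵇ-suc-strict k strict) (length-complementCol-suc k C) ⟩
  (count (_≤ᵇ k) C + indicator k+1∈C) + (length (complementCol k C) + indicator (not k+1∈C))
    ≡⟨ interchange (count (_≤ᵇ k) C) _ _ _ ⟩
  (count (_≤ᵇ k) C + length (complementCol k C)) + (indicator k+1∈C + indicator (not k+1∈C))
    ≡⟨ cong₂ _+_ (count+length-complementCol k strict positive) (indicator-+-not k+1∈C) ⟩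
  k + 1
    ≡⟨ +-comm k 1 ⟩
  suc k ∎
  where
    open ≡-Reasoning
    k+1∈C = any (suc k ≡ᵇ_) C

hasEntry≤ : ℕ → ℕ → Column → Bool
hasEntry≤ k s C = maybe′ (_≤ᵇ k) false (entryAt C s)

flagOf-count : ∀ tab k s → flagOf tab k (suc s) ≡ count′ (hasEntry≤ k s) tab
flagOf-count tab k s = count′-mapMaybe (_≤ᵇ k) (λ C → entryAt C s) tab

rowCompatible⇒Downward : ∀ {k s tab} → Linked RowCompatible tab → Downward (hasEntry≤ k s) tab
rowCompatible⇒Downward {k} {s} = Linked.map leftHasEntry
  where
    leftHasEntry : ∀ {C D} → RowCompatible C D → T (hasEntry≤ k s D) → T (hasEntry≤ k s C)
    leftHasEntry {C} {D} (|D|≤|C| , rowWeak) t with to (T-maybe′ _ (entryAt D s)) t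
    ... | y , Ds≡y , y≤k with length⇒at C s (<-≤-trans (at-length D s Ds≡y) |D|≤|C|)
    ...   | x , Cs≡x =
      from (T-maybe′ _ (entryAt C s))
           (x , Cs≡x , ≤⇒≤ᵇ (≤-trans (rowWeak s x y Cs≡x Ds≡y) (≤ᵇ⇒≤ y k y≤k)))

flagOf-column : ∀ {tab j C} → Linked RowCompatible tab → Linked _≤_ C → at tab j ≡ just C →
                ∀ k s → j < flagOf tab k (suc s) ⇔ s < count (_≤ᵇ k) C
flagOf-column {tab} {j} {C} rows sorted tabj≡C k s = begin
  j < flagOf tab k (suc s)
    ≡⟨ cong (j <_) (flagOf-count tab k s) ⟩
  j < count′ (hasEntry≤ k s) tab
    ∼⟨ count′-Downward (rowCompatible⇒Downward {k} {s} rows) j ⟩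
  (∃[ D ] at tab j ≡ just D × T (hasEntry≤ k s D))
    ∼⟨ mk⇔ (λ { (_ , tabj≡D , t) → subst (T ∘ hasEntry≤ k s) (just-injective (trans (sym tabj≡D) tabj≡C)) t })
           (λ t → C , tabj≡C , t) ⟩
  T (hasEntry≤ k s C)
    ∼⟨ T-maybe′ _ (entryAt C s) ⟩
  (∃[ x ] at C s ≡ just x × T (x ≤ᵇ k))
    ∼⟨ ⇔-sym (count′-Downward (sorted⇒Downward sorted) s) ⟩
  s < count (_≤ᵇ k) C ∎
  where open EquationalReasoning

flagOf-≤-length : ∀ tab k s → flagOf tab k (suc s) ≤ length tab
flagOf-≤-length tab k s = subst (_≤ length tab) (sym (flagOf-count tab k s)) (length-filter (T? ∘ hasEntry≤ k s) tab)

jigsaw-≤ : ∀ n μ {k r} → 1 ≤ r → r ≤ k → jigsaw n μ k r ≡ μ n 1 ∸ μ k (suc k ∸ r)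
jigsaw-≤ n μ {k} {suc r} _ r<k rewrite ≤ᵇ-true r<k = refl

jigsaw-> : ∀ n μ {k r} → k < r → jigsaw n μ k r ≡ 0
jigsaw-> n μ {k} {suc r} k<r rewrite ≤ᵇ-false (<⇒≱ k<r) = refl

flagColumn : ℕ → Flag → ℕ → Column
flagColumn n μ c = filterᵇ (λ k → colLen n μ (k ∸ 1) c <ᵇ colLen n μ k c) (range n)

nonEmpty-length : ∀ xs → nonEmpty xs ≡ (1 ≤ᵇ length xs)
nonEmpty-length []      = refl
nonEmpty-length (_ ∷ _) = refl

SSYT-zero : ∀ {tab} → SSYT 0 tab → tab ≡ []
SSYT-zero {[]}          _                                = refl
SSYT-zero {[] ∷ _}      ((C≢[] ∷ _) , _)                  = contradiction refl C≢[]
SSYT-zero {(_ ∷ _) ∷ _} (_ , (((1≤x , x≤0) ∷ _) ∷ _) , _) = contradiction (≤-trans 1≤x x≤0) λ ()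

-- n ≥ 1 here: `row` reads row 0 as row 1, so `flagOf tab n n` is λ^{(n)}_n only for n ≥ 1.
module JigsawColumns {n′ : ℕ} {tab : Tableau} (ssyt : SSYT (suc n′) tab) where

  n ℓ : ℕ
  n = suc n′
  ℓ = length tab

  μ : Flag
  μ = jigsaw n (flagOf tab)

  rows : Linked RowCompatible tab
  rows = proj₂ (proj₂ (proj₂ ssyt))

  module Column (j : ℕ) {C} (tabj≡C : at tab j ≡ just C) where

    strict : Linked _<_ C
    strict = All-at (proj₁ (proj₂ (proj₂ ssyt))) j tabj≡C

    <flagOf⇔<count : ∀ k s → j < flagOf tab k (suc s) ⇔ s < count (_≤ᵇ k) C
    <flagOf⇔<count = flagOf-column rows (Linked.map <⇒≤ strict) tabj≡C

    count+length-complement : ∀ k → count (_≤ᵇ k) C + length (complementCol k C) ≡ k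
    count+length-complement k =
      count+length-complementCol k strict (All.map proj₁ (All-at (proj₁ (proj₂ ssyt)) j tabj≡C))

    length-complement : ∀ k → length (complementCol k C) ≡ k ∸ count (_≤ᵇ k) C
    length-complement k =
      trans (sym (m+n∸m≡n (count (_≤ᵇ k) C) _)) (cong (_∸ count (_≤ᵇ k) C) (count+length-complement k))

    count≤ : ∀ k → count (_≤ᵇ k) C ≤ k
    count≤ k = subst (count (_≤ᵇ k) C ≤_) (count+length-complement k) (m≤m+n _ _)

    length-complement≤ : ∀ k → length (complementCol k C) ≤ k
    length-complement≤ k = subst (length (complementCol k C) ≤_) (count+length-complement k) (m≤n+m _ _)

  flagOf-firstRow : flagOf tab n 1 ≡ ℓ
  flagOf-firstRow = trans (flagOf-count tab n 0)
    (cong length (filter-all (T? ∘ hasEntry≤ n 0) (All.zipWith firstEntry (proj₁ ssyt , proj₁ (proj₂ ssyt)))))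
    where
      firstEntry : ∀ {C} → C ≢ [] × All (λ x → 1 ≤ x × x ≤ n) C → T (hasEntry≤ n 0 C)
      firstEntry {[]}    (C≢[] , _)              = contradiction refl C≢[]
      firstEntry {_ ∷ _} (_ , (_ , x≤n) ∷ _)     = ≤⇒≤ᵇ x≤n

  jigsaw-reaches : ∀ j {C} → at tab j ≡ just C → ∀ k r → 1 ≤ r →
                   (ℓ ∸ j ≤ᵇ μ k r) ≡ (r ≤ᵇ length (complementCol k C))
  jigsaw-reaches j {C} tabj≡C k r 1≤r with r ≤? k
  ... | yes r≤k = begin
    (ℓ ∸ j ≤ᵇ μ k r)  ≡⟨ cong (ℓ ∸ j ≤ᵇ_) μkr≡ℓ∸x ⟩
    (ℓ ∸ j ≤ᵇ ℓ ∸ x)  ≡⟨ does-⇔ (mk⇔ reaches⇒ ⇒reaches) (ℓ ∸ j ≤? ℓ ∸ x) (r ≤? d) ⟩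
    (r ≤ᵇ d)          ∎
    where
      open ≡-Reasoning
      open Column j tabj≡C
      c = count (_≤ᵇ k) C
      d = length (complementCol k C)
      x = flagOf tab k (suc (k ∸ r))
      μkr≡ℓ∸x : μ k r ≡ ℓ ∸ x
      μkr≡ℓ∸x = trans (jigsaw-≤ n (flagOf tab) 1≤r r≤k)
                      (cong₂ _∸_ flagOf-firstRow (cong (flagOf tab k) (+-∸-assoc 1 r≤k)))
      x≤j⇔c≤k∸r : x ≤ j ⇔ c ≤ k ∸ r
      x≤j⇔c≤k∸r = mk⇔ (λ x≤j → ≮⇒≥ (λ k∸r<c → <⇒≱ (from (<flagOf⇔<count k (k ∸ r)) k∸r<c) x≤j))
                      (λ c≤k∸r → ≮⇒≥ (λ j<x → <⇒≱ (to (<flagOf⇔<count k (k ∸ r)) j<x) c≤k∸r))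
      reaches⇒ : ℓ ∸ j ≤ ℓ ∸ x → r ≤ d
      reaches⇒ h = subst (r ≤_) (sym (length-complement k))
                     (≤∸⇒≤∸ r≤k (to x≤j⇔c≤k∸r (∸-cancelʳ-≤′ (at-length tab j tabj≡C) h)))
      ⇒reaches : r ≤ d → ℓ ∸ j ≤ ℓ ∸ x
      ⇒reaches r≤d = ∸-monoʳ-≤ ℓ (from x≤j⇔c≤k∸r
                       (≤∸⇒≤∸ (count≤ k) (subst (r ≤_) (length-complement k) r≤d)))
  ... | no r≰k =
    trans (cong (ℓ ∸ j ≤ᵇ_) (jigsaw-> n (flagOf tab) (≰⇒> r≰k)))
          (does-⇔ (mk⇔ (λ h → contradiction h (<⇒≱ (m<n⇒0<n∸m (at-length tab j tabj≡C))))
                       (λ r≤d → contradiction (≤-trans r≤d (Column.length-complement≤ j tabj≡C k)) r≰k))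
                  (ℓ ∸ j ≤? 0) (r ≤? length (complementCol k C)))

  colLen-jigsaw : ∀ j {C} → at tab j ≡ just C → ∀ {k} → k ≤ n →
                  colLen n μ k (ℓ ∸ j) ≡ length (complementCol k C)
  colLen-jigsaw j {C} tabj≡C {k} k≤n = begin
    colLen n μ k (ℓ ∸ j)
      ≡⟨ cong length (filterᵇ-cong-range n {q = _≤ᵇ d} (λ r 1≤r _ → jigsaw-reaches j tabj≡C k r 1≤r)) ⟩
    count (_≤ᵇ d) (range n)
      ≡⟨ count-≤ᵇ-range d n ⟩
    n ⊓ d
      ≡⟨ m≥n⇒m⊓n≡n (≤-trans (Column.length-complement≤ j tabj≡C k) k≤n) ⟩
    d ∎
    where
      open ≡-Reasoning
      d = length (complementCol k C)

  flagColumn-jigsaw : ∀ j {C} → at tab j ≡ just C → flagColumn n μ (ℓ ∸ j) ≡ complementCol n C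
  flagColumn-jigsaw j {C} tabj≡C = filterᵇ-cong-range n newEntry
    where
      newEntry : ∀ k → 1 ≤ k → k ≤ n →
                 (colLen n μ (k ∸ 1) (ℓ ∸ j) <ᵇ colLen n μ k (ℓ ∸ j)) ≡ not (any (k ≡ᵇ_) C)
      newEntry (suc k) _ k<n = begin
        (colLen n μ k (ℓ ∸ j) <ᵇ colLen n μ (suc k) (ℓ ∸ j))
          ≡⟨ cong₂ _<ᵇ_ (colLen-jigsaw j tabj≡C (<⇒≤ k<n)) (colLen-jigsaw j tabj≡C k<n) ⟩
        (length (complementCol k C) <ᵇ length (complementCol (suc k) C))
          ≡⟨ cong (length (complementCol k C) <ᵇ_) (length-complementCol-suc k C) ⟩
        (length (complementCol k C) <ᵇ length (complementCol k C) + indicator (not (any (suc k ≡ᵇ_) C)))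
          ≡⟨ <ᵇ-+-indicator (length (complementCol k C)) _ ⟩
        not (any (suc k ≡ᵇ_) C) ∎
        where open ≡-Reasoning

  fullColumns : ℕ
  fullColumns = flagOf tab n n

  nonEmpty-complementCol : ∀ j {C} → at tab j ≡ just C → nonEmpty (complementCol n C) ≡ (fullColumns ≤ᵇ j)
  nonEmpty-complementCol j {C} tabj≡C =
    trans (nonEmpty-length (complementCol n C))
          (does-⇔ (mk⇔ notFull⇒ ⇒notFull) (1 ≤? length (complementCol n C)) (fullColumns ≤? j))
    where
      open Column j tabj≡C
      notFull⇒ : 1 ≤ length (complementCol n C) → fullColumns ≤ j
      notFull⇒ 1≤d = ≮⇒≥ λ j<full →
        <⇒≱ (subst (1 ≤_) (trans (length-complement n) (m≤n⇒m∸n≡0 (to (<flagOf⇔<count n n′) j<full))) 1≤d) ≤-refl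
      ⇒notFull : fullColumns ≤ j → 1 ≤ length (complementCol n C)
      ⇒notFull full≤j = subst (1 ≤_) (sym (length-complement n))
        (m<n⇒0<n∸m (s≤s (≮⇒≥ λ n′<c → <⇒≱ (from (<flagOf⇔<count n n′) n′<c) full≤j)))

  μ-width : μ n 1 ≡ ℓ ∸ fullColumns
  μ-width = trans (jigsaw-≤ n (flagOf tab) (s≤s z≤n) (s≤s z≤n)) (cong (_∸ fullColumns) flagOf-firstRow)

  μ-width≤ℓ : μ n 1 ≤ ℓ
  μ-width≤ℓ = subst (_≤ ℓ) (sym μ-width) (m∸n≤m ℓ fullColumns)

  nonEmpty-flagColumn : ∀ c → 1 ≤ c → c ≤ ℓ → nonEmpty (flagColumn n μ c) ≡ (c ≤ᵇ μ n 1)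
  nonEmpty-flagColumn c 1≤c c≤ℓ with length⇒at tab (ℓ ∸ c) (∸-monoʳ-< 1≤c c≤ℓ)
  ... | C , tab[ℓ∸c]≡C = begin
    nonEmpty (flagColumn n μ c)             ≡⟨ cong (nonEmpty ∘ flagColumn n μ) (m∸[m∸n]≡n c≤ℓ) ⟨
    nonEmpty (flagColumn n μ (ℓ ∸ (ℓ ∸ c))) ≡⟨ cong nonEmpty (flagColumn-jigsaw (ℓ ∸ c) tab[ℓ∸c]≡C) ⟩
    nonEmpty (complementCol n C)            ≡⟨ nonEmpty-complementCol (ℓ ∸ c) tab[ℓ∸c]≡C ⟩
    (fullColumns ≤ᵇ ℓ ∸ c)                  ≡⟨ does-⇔ (mk⇔ (≤∸⇒≤∸ c≤ℓ) (≤∸⇒≤∸ (flagOf-≤-length tab n n′)))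
                                                      (fullColumns ≤? ℓ ∸ c) (c ≤? ℓ ∸ fullColumns) ⟩
    (c ≤ᵇ ℓ ∸ fullColumns)                  ≡⟨ cong (c ≤ᵇ_) μ-width ⟨
    (c ≤ᵇ μ n 1)                            ∎
    where open ≡-Reasoning

proposition4p1 : (n : ℕ) (T : Tableau) → SSYT n T →
    tableauOfFlag n (jigsaw n (flagOf T)) ≡ complementTableau n T
proposition4p1 zero    tab ssyt with refl ← SSYT-zero ssyt = refl
proposition4p1 (suc n′) tab ssyt = begin
  tableauOfFlag n μ
    ≡⟨⟩
  map (flagColumn n μ) (range (μ n 1))
    ≡⟨ filterᵇ-map-range-prefix nonEmpty (flagColumn n μ) ℓ μ-width≤ℓ nonEmpty-flagColumn ⟨
  filterᵇ nonEmpty (map (flagColumn n μ) (range ℓ))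
    ≡⟨ cong (filterᵇ nonEmpty) (map-range-reverse (flagColumn n μ) (complementCol n) tab flagColumn-jigsaw) ⟩
  filterᵇ nonEmpty (map (complementCol n) (reverse tab))
    ≡⟨⟩
  complementTableau n tab ∎
  where
    open ≡-Reasoning
    open JigsawColumns ssyt
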